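{- Let $\mathcal{R}$ be a set of atomic rules and consider the logic-free calculus $\mathcal{R}$. If a sequent $\Gamma\Rightarrow\Delta$ has a derivation $\mathcal{D}$ in $\mathcal{R}$, then there is a subsequent $\Gamma^\circ\Rightarrow\Delta^\circ$ of $\Gamma\Rightarrow\Delta$ (i.e. $\Gamma^\circ\subseteq\Gamma$ and $\Delta^\circ\subseteq\Delta$ as multisets) consisting of atomic formulae only, which has a derivation $\mathcal{D}^\circ$ in $\mathcal{R}$ in which all sequents are atomic (contain only atomic formulae), such that $h(\mathcal{D}^\circ)\le h(\mathcal{D})$.
   Context: Formulae are first-order formulae (function symbols allowed) built from atomic formulae and $\bot$ with $\wedge,\vee,\rightarrow,\forall,\exists$. A sequent $\Gamma\Rightarrow\Delta$ has finite multisets $\Gamma,\Delta$ of formulae. An atomic rule is a rule of the form: from premisses $\vec{Q_i},\Gamma_i\Rightarrow\Delta_i,\vec{Q_i'}$ ($i=1,\dots,n$) infer $\vec{P},\Gamma_1,\dots,\Gamma_n\Rightarrow\Delta_1,\dots,\Delta_n,\vec{P'}$, where $\vec{Q_i},\vec{Q_i'},\vec P,\vec{P'}$ are (possibly empty) sequences of atomic formulae and $\Gamma_i,\Delta_i$ are arbitrary (possibly empty) contexts. For a set $\mathcal{R}$ of atomic rules, "the calculus $\mathcal{R}$" (the logic-free calculus) has as initial sequents exactly $P,\Gamma\Rightarrow\Delta,P$ with $P$ atomic and $\Gamma,\Delta$ arbitrary, and as rules exactly those in $\mathcal{R}$. The height $h(\mathcal{D})$ of a derivation is the maximal number of inferences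 along a branch (a derivation consisting of an initial sequent has height $0$). -}

module Defs where

open import Data.Nat using (ℕ; zero; suc; _⊔_)
open import Data.List using (List; []; _∷_; _++_; map; concat)
open import Data.List.Relation.Unary.All using (All)
open import Data.List.Relation.Binary.Permutation.Propositional using (_↭_)
open import Data.Product using (_×_; _,_; proj₁; proj₂; ∃)
open import Data.Unit using (⊤)
open import Relation.Binary.PropositionalEquality using (_≡_)

data Term : Set where
  var : ℕ → Term
  fun : ℕ → List Term → Term

record Atom : Set where
  constructor _⟨_⟩
  field
    pred : ℕ
    args : List Term

data Formula : Set where
  atom : Atom → Formula
  ⊥'   : Formula
  _∧'_ : Formula → Formula → Formula
  _∨'_ : Formula → Formula → Formula
  _⇒'_ : Formula → Formula → Formula
  ∀'   : ℕ → Formula → Formula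
  ∃'   : ℕ → Formula → Formula

IsAtomic : Formula → Set
IsAtomic φ = ∃ λ (a : Atom) → φ ≡ atom a

atoms : List Atom → List Formula
atoms = map atom

-- An atomic rule: premisses  Q⃗ᵢ, Γᵢ ⇒ Δᵢ, Q⃗ᵢ'  (i = 1..n),
-- conclusion  P⃗, Γ₁..Γₙ ⇒ Δ₁..Δₙ, P⃗'.
-- Each premiss schema is the pair (Q⃗ᵢ , Q⃗ᵢ'), the conclusion schema is (P⃗ , P⃗').
record AtomicRule : Set where
  field
    premisses : List (List Atom × List Atom)
    concl     : List Atom × List Atom
open AtomicRule public

Ctx : Set
Ctx = List Formula × List Formula

-- Sequents are pairs of finite multisets, represented by lists up to
-- permutation (_↭_).  Derivations in the logic-free calculus R, where R is a
-- set of atomic rules given as a predicate.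
mutual
  data Deriv (R : AtomicRule → Set) : List Formula → List Formula → Set where
    init : ∀ {Γ Δ} (P : Atom) (Γ' Δ' : List Formula) →
           Γ ↭ (atom P ∷ Γ') → Δ ↭ (Δ' ++ (atom P ∷ [])) →
           Deriv R Γ Δ
    rule : ∀ {Γ Δ} (ρ : AtomicRule) → R ρ → (cs : List Ctx) →
           Prems R (premisses ρ) cs →
           Γ ↭ (atoms (proj₁ (concl ρ)) ++ concat (map proj₁ cs)) →
           Δ ↭ (concat (map proj₂ cs) ++ atoms (proj₂ (concl ρ))) →
           Deriv R Γ Δ

  data Prems (R : AtomicRule → Set) :
         List (List Atom × List Atom) → List Ctx → Set where
    []  : Prems R [] []
    _∷_ : ∀ {Q Q' Γᵢ Δᵢ qs cs} →
          Deriv R (atoms Q ++ Γᵢ) (Δᵢ ++ atoms Q') →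
          Prems R qs cs →
          Prems R ((Q , Q') ∷ qs) ((Γᵢ , Δᵢ) ∷ cs)

mutual
  height : ∀ {R Γ Δ} → Deriv R Γ Δ → ℕ
  height (init _ _ _ _ _)    = 0
  height (rule _ _ _ ps _ _) = suc (heights ps)

  heights : ∀ {R qs cs} → Prems R qs cs → ℕ
  heights []       = 0
  heights (d ∷ ps) = height d ⊔ heights ps

mutual
  AtomicDeriv : ∀ {R Γ Δ} → Deriv R Γ Δ → Set
  AtomicDeriv {Γ = Γ} {Δ} (init _ _ _ _ _) = All IsAtomic Γ × All IsAtomic Δ
  AtomicDeriv {Γ = Γ} {Δ} (rule _ _ _ ps _ _) =
    All IsAtomic Γ × All IsAtomic Δ × AtomicPrems ps

  AtomicPrems : ∀ {R qs cs} → Prems R qs cs → Set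
  AtomicPrems []       = ⊤
  AtomicPrems (d ∷ ps) = AtomicDeriv d × AtomicPrems ps

_⊆ₘ_ : List Formula → List Formula → Set
Γ° ⊆ₘ Γ = ∃ λ (Γʳ : List Formula) → Γ ↭ (Γ° ++ Γʳ)

-- Erase every non-atomic formula from every sequent of the derivation.
-- Initial sequents and atomic rules only inspect their atomic principal
-- formulae; non-atomic formulae sit in the contexts Γᵢ, Δᵢ, which a rule
-- passes up unchanged, so the erased tree is again a derivation, now of the
-- atomic part of the endsequent, with the same shape and hence the same height.
module Submission where

open import Defs
open import Data.Nat using (suc; _⊔_; _≤_)
open import Data.Nat.Properties using (≤-reflexive)
open import Data.Unit using (tt)
open import Data.Product using (_×_; Σ; ∃; _,_; proj₁; proj₂)
open import Data.List using (List; []; _∷_; _++_; map; concat; filter)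
open import Data.List.Properties using (filter-++; filter-all; partition-defn; map-∘)
open import Data.List.Relation.Unary.All using (All; universal)
open import Data.List.Relation.Unary.All.Properties using (all-filter)
import Data.List.Relation.Unary.All.Properties as All
open import Data.List.Relation.Binary.Permutation.Propositional
  using (_↭_; ↭-refl; ↭-reflexive; ↭-sym; ↭-trans; ↭ₛ⇒↭)
open import Data.List.Relation.Binary.Permutation.Propositional.Properties
  using (All-resp-↭; filter-↭)
import Data.List.Relation.Binary.Permutation.Setoid.Properties as ↭ₛ
open import Function using (_∘_)
open import Relation.Nullary using (yes; no)
open import Relation.Unary using (Decidable)
open import Relation.Unary.Properties using (∁?)
open import Relation.Binary.PropositionalEquality
  using (_≡_; refl; cong; cong₂; sym; setoid; subst; module ≡-Reasoning)

isAtomic? : Decidable IsAtomic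
isAtomic? (atom a)  = yes (a , refl)
isAtomic? ⊥'        = no λ ()
isAtomic? (_ ∧' _)  = no λ ()
isAtomic? (_ ∨' _)  = no λ ()
isAtomic? (_ ⇒' _)  = no λ ()
isAtomic? (∀' _ _)  = no λ ()
isAtomic? (∃' _ _)  = no λ ()

atomicPart : List Formula → List Formula
atomicPart = filter isAtomic?

atomicPart-⊆ₘ : ∀ Γ → atomicPart Γ ⊆ₘ Γ
atomicPart-⊆ₘ Γ = filter (∁? isAtomic?) Γ ,
  subst (Γ ↭_) (cong (λ p → proj₁ p ++ proj₂ p) (partition-defn isAtomic? Γ))
        (↭ₛ⇒↭ (↭ₛ.partition-↭ (setoid Formula) isAtomic? Γ))

atomicPart-atomic : ∀ Γ → All IsAtomic (atomicPart Γ)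
atomicPart-atomic = all-filter isAtomic?

↭-atomicPart⇒atomic : ∀ Γ {Γ°} → Γ° ↭ atomicPart Γ → All IsAtomic Γ°
↭-atomicPart⇒atomic Γ Γ°↭ = All-resp-↭ (↭-sym Γ°↭) (atomicPart-atomic Γ)

atomicPart-atoms : ∀ Q → atomicPart (atoms Q) ≡ atoms Q
atomicPart-atoms Q = filter-all isAtomic? (All.map⁺ (universal (λ a → a , refl) Q))

atomicPart-concat : ∀ xss → atomicPart (concat xss) ≡ concat (map atomicPart xss)
atomicPart-concat []         = refl
atomicPart-concat (xs ∷ xss) = begin
  atomicPart (xs ++ concat xss)                  ≡⟨ filter-++ isAtomic? xs (concat xss) ⟩
  atomicPart xs ++ atomicPart (concat xss)       ≡⟨ cong (atomicPart xs ++_) (atomicPart-concat xss) ⟩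
  atomicPart xs ++ concat (map atomicPart xss)   ∎
  where open ≡-Reasoning

atomicPart-atoms-++ : ∀ Q Γ → atomicPart (atoms Q ++ Γ) ≡ atoms Q ++ atomicPart Γ
atomicPart-atoms-++ Q Γ = begin
  atomicPart (atoms Q ++ Γ)            ≡⟨ filter-++ isAtomic? (atoms Q) Γ ⟩
  atomicPart (atoms Q) ++ atomicPart Γ ≡⟨ cong (_++ atomicPart Γ) (atomicPart-atoms Q) ⟩
  atoms Q ++ atomicPart Γ              ∎
  where open ≡-Reasoning

atomicPart-++-atoms : ∀ Δ Q → atomicPart (Δ ++ atoms Q) ≡ atomicPart Δ ++ atoms Q
atomicPart-++-atoms Δ Q = begin
  atomicPart (Δ ++ atoms Q)            ≡⟨ filter-++ isAtomic? Δ (atoms Q) ⟩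
  atomicPart Δ ++ atomicPart (atoms Q) ≡⟨ cong (atomicPart Δ ++_) (atomicPart-atoms Q) ⟩
  atomicPart Δ ++ atoms Q              ∎
  where open ≡-Reasoning

atomicCtx : Ctx → Ctx
atomicCtx c = atomicPart (proj₁ c) , atomicPart (proj₂ c)

atomicPart-antecedent : ∀ P cs →
  atomicPart (atoms P ++ concat (map proj₁ cs)) ≡ atoms P ++ concat (map proj₁ (map atomicCtx cs))
atomicPart-antecedent P cs = begin
  atomicPart (atoms P ++ concat (map proj₁ cs))     ≡⟨ atomicPart-atoms-++ P (concat (map proj₁ cs)) ⟩
  atoms P ++ atomicPart (concat (map proj₁ cs))     ≡⟨ cong (atoms P ++_) (atomicPart-concat (map proj₁ cs)) ⟩
  atoms P ++ concat (map atomicPart (map proj₁ cs)) ≡⟨ cong (λ xss → atoms P ++ concat xss) (map-∘ cs) ⟨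
  atoms P ++ concat (map (proj₁ ∘ atomicCtx) cs)    ≡⟨ cong (λ xss → atoms P ++ concat xss) (map-∘ cs) ⟩
  atoms P ++ concat (map proj₁ (map atomicCtx cs))  ∎
  where open ≡-Reasoning

atomicPart-succedent : ∀ P cs →
  atomicPart (concat (map proj₂ cs) ++ atoms P) ≡ concat (map proj₂ (map atomicCtx cs)) ++ atoms P
atomicPart-succedent P cs = begin
  atomicPart (concat (map proj₂ cs) ++ atoms P)     ≡⟨ atomicPart-++-atoms (concat (map proj₂ cs)) P ⟩
  atomicPart (concat (map proj₂ cs)) ++ atoms P     ≡⟨ cong (_++ atoms P) (atomicPart-concat (map proj₂ cs)) ⟩
  concat (map atomicPart (map proj₂ cs)) ++ atoms P ≡⟨ cong (λ xss → concat xss ++ atoms P) (map-∘ cs) ⟨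
  concat (map (proj₂ ∘ atomicCtx) cs) ++ atoms P    ≡⟨ cong (λ xss → concat xss ++ atoms P) (map-∘ cs) ⟩
  concat (map proj₂ (map atomicCtx cs)) ++ atoms P  ∎
  where open ≡-Reasoning

module _ {R : AtomicRule → Set} where

  -- The endsequent is fixed only up to ↭, so that the premisses can be
  -- reindexed to atoms Q ++ atomicPart Γᵢ without transport along _≡_.
  mutual
    restrict : ∀ {Γ Δ Γ° Δ°} → Deriv R Γ Δ →
               Γ° ↭ atomicPart Γ → Δ° ↭ atomicPart Δ → Deriv R Γ° Δ°
    restrict (init P Γ' Δ' p q) Γ°↭ Δ°↭ =
      init P (atomicPart Γ') (atomicPart Δ')
        (↭-trans Γ°↭ (filter-↭ isAtomic? p))
        (↭-trans Δ°↭ (↭-trans (filter-↭ isAtomic? q)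
                               (↭-reflexive (filter-++ isAtomic? Δ' _))))
    restrict (rule ρ r cs ps p q) Γ°↭ Δ°↭ =
      rule ρ r (map atomicCtx cs) (restrictPrems ps)
        (↭-trans Γ°↭ (↭-trans (filter-↭ isAtomic? p)
                               (↭-reflexive (atomicPart-antecedent (proj₁ (concl ρ)) cs))))
        (↭-trans Δ°↭ (↭-trans (filter-↭ isAtomic? q)
                               (↭-reflexive (atomicPart-succedent (proj₂ (concl ρ)) cs))))

    restrictPrems : ∀ {qs cs} → Prems R qs cs → Prems R qs (map atomicCtx cs)
    restrictPrems [] = []
    restrictPrems (_∷_ {Q} {Q'} {Γᵢ} {Δᵢ} d ps) =
      restrict d (↭-reflexive (sym (atomicPart-atoms-++ Q Γᵢ)))
                 (↭-reflexive (sym (atomicPart-++-atoms Δᵢ Q'))) ∷ restrictPrems ps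

  mutual
    restrict-atomic : ∀ {Γ Δ Γ° Δ°} (D : Deriv R Γ Δ)
                      (Γ°↭ : Γ° ↭ atomicPart Γ) (Δ°↭ : Δ° ↭ atomicPart Δ) →
                      AtomicDeriv (restrict D Γ°↭ Δ°↭)
    restrict-atomic {Γ} {Δ} (init _ _ _ _ _) Γ°↭ Δ°↭ =
      ↭-atomicPart⇒atomic Γ Γ°↭ , ↭-atomicPart⇒atomic Δ Δ°↭
    restrict-atomic {Γ} {Δ} (rule _ _ _ ps _ _) Γ°↭ Δ°↭ =
      ↭-atomicPart⇒atomic Γ Γ°↭ , ↭-atomicPart⇒atomic Δ Δ°↭ , restrictPrems-atomic ps

    restrictPrems-atomic : ∀ {qs cs} (ps : Prems R qs cs) → AtomicPrems (restrictPrems ps)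
    restrictPrems-atomic []       = tt
    restrictPrems-atomic (d ∷ ps) = restrict-atomic d _ _ , restrictPrems-atomic ps

  mutual
    height-restrict : ∀ {Γ Δ Γ° Δ°} (D : Deriv R Γ Δ)
                      (Γ°↭ : Γ° ↭ atomicPart Γ) (Δ°↭ : Δ° ↭ atomicPart Δ) →
                      height (restrict D Γ°↭ Δ°↭) ≡ height D
    height-restrict (init _ _ _ _ _)    _ _ = refl
    height-restrict (rule _ _ _ ps _ _) _ _ = cong suc (heights-restrictPrems ps)

    heights-restrictPrems : ∀ {qs cs} (ps : Prems R qs cs) → heights (restrictPrems ps) ≡ heights ps
    heights-restrictPrems []       = refl
    heights-restrictPrems (d ∷ ps) = cong₂ _⊔_ (height-restrict d _ _) (heights-restrictPrems ps)

lemma1 : (R : AtomicRule → Set) {Γ Δ : List Formula} (D : Deriv R Γ Δ) →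
           ∃ λ (Γ° : List Formula) → ∃ λ (Δ° : List Formula) →
             Γ° ⊆ₘ Γ × Δ° ⊆ₘ Δ × All IsAtomic Γ° × All IsAtomic Δ° ×
             Σ (Deriv R Γ° Δ°) (λ D° → AtomicDeriv D° × height D° ≤ height D)
lemma1 R {Γ} {Δ} D =
  atomicPart Γ , atomicPart Δ , atomicPart-⊆ₘ Γ , atomicPart-⊆ₘ Δ ,
  atomicPart-atomic Γ , atomicPart-atomic Δ ,
  restrict D ↭-refl ↭-refl ,
  restrict-atomic D ↭-refl ↭-refl , ≤-reflexive (height-restrict D ↭-refl ↭-refl)
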